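{- Let $\mathbf{k}=(k_1,\ldots,k_r)$ be an index with $r\ge 2$. For each prime $p$ let $\zeta_p$ be a primitive $p$-th root of unity, and identify $\mathbb{Z}[\zeta_p]/(1-\zeta_p)\mathbb{Z}[\zeta_p]$ with $\mathbb{F}_p$. Then $\omega_p(\mathbf{k};\zeta_p)\in\mathbb{Z}[\zeta_p]$ for every prime $p$, and \[ \left(\omega_p(\mathbf{k};\zeta_p) \bmod (1-\zeta_p)\mathbb{Z}[\zeta_p]\right)_p = \omega_{\mathcal{A}}(\mathbf{k}) \in \mathcal{A}.\]
   Context: An index is a tuple $\mathbf{k}=(k_1,\ldots,k_r)$ of positive integers. Let $\mathcal{A}=\big(\prod_{p}\mathbb{F}_p\big)/\big(\bigoplus_p \mathbb{F}_p\big)$, $p$ running over all primes; elements are written $(a_p)_p$ and two elements are equal iff $a_p=b_p$ for all but finitely many $p$; rationals embed into $\mathcal{A}$ by reducing mod $p$ (and setting $a_p=0$ when $p$ divides the denominator). For $n\in\mathbb{N}$ put $\omega_n(\mathbf{k})=\sum_{m_1+\cdots+m_r=n,\ m_i>0}\prod_{a=1}^r m_a^{ -k_a}\in\mathbb{Q}$ and $\omega_{\mathcal{A}}(\mathbf{k})=(\omega_p(\mathbf{k}) \bmod p)_p\in\mathcal{A}$ (for $r\ge2$). With the $q$-integer $[m]=1+q+\cdots+q^{m-1}=\frac{1-q^m}{1-q}$, define $\omega_n(\mathbf{k};q)=\sum_{m_1+\cdots+m_r=n,\ m_i>0}\prod_{a=1}^r \frac{q^{(k_a-1)m_a}}{[m_a]^{k_a}}$;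 for $r\ge2$ each $m_a<n$, so this rational function can be evaluated at a primitive $n$-th root of unity. -}

module Defs where

open import Data.Nat as ℕ using (ℕ; zero; suc; _∸_)
open import Data.Integer as ℤ using (ℤ; +_)
open import Data.Integer.Divisibility as ℤd using ()
open import Data.Rational as ℚ using (ℚ; 0ℚ; 1ℚ; ↥_; ↧_)
open import Data.List using (List; []; _∷_; map; upTo; concatMap; replicate; _++_; foldr; zipWith; length)
open import Data.Product using (Σ; _×_)
open import Relation.Nullary using (¬_)

-- Univariate polynomials with rational coefficients (lowest degree first)

Poly : Set
Poly = List ℚ

infixl 6 _+ₚ_ _-ₚ_
infixl 7 _*ₚ_

_+ₚ_ : Poly → Poly → Poly
[] +ₚ g = g
(a ∷ f) +ₚ [] = a ∷ f
(a ∷ f) +ₚ (b ∷ g) = (a ℚ.+ b) ∷ (f +ₚ g)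

scaleₚ : ℚ → Poly → Poly
scaleₚ a = map (a ℚ.*_)

_*ₚ_ : Poly → Poly → Poly
[] *ₚ g = []
(a ∷ f) *ₚ g = scaleₚ a g +ₚ (0ℚ ∷ (f *ₚ g))

_-ₚ_ : Poly → Poly → Poly
f -ₚ g = f +ₚ map ℚ.-_ g

oneₚ : Poly
oneₚ = 1ℚ ∷ []

_^ₚ_ : Poly → ℕ → Poly
f ^ₚ zero = oneₚ
f ^ₚ suc n = f *ₚ (f ^ₚ n)

xpow : ℕ → Poly
xpow n = replicate n 0ℚ ++ (1ℚ ∷ [])

coeff : Poly → ℕ → ℚ
coeff [] i = 0ℚ
coeff (a ∷ f) zero = a
coeff (a ∷ f) (suc i) = coeff f i

intPoly : List ℤ → Poly
intPoly = map (λ z → z ℚ./ 1)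

evalOne : List ℤ → ℤ
evalOne = foldr ℤ._+_ (+ 0)

-- ℚ(ζ_p) = ℚ[q]/(Φ_p(q)),  Φ_p = 1 + q + ... + q^{p-1}  (p prime)

Φ : ℕ → Poly
Φ p = replicate p 1ℚ

-- f ≈[ p ] g : f(ζ_p) = g(ζ_p), i.e. Φ_p divides f - g in ℚ[q]
_≈[_]_ : Poly → ℕ → Poly → Set
f ≈[ p ] g = Σ Poly (λ h → ∀ i → coeff (f -ₚ g) i ≡ coeff (h *ₚ Φ p) i)
  where open import Relation.Binary.PropositionalEquality using (_≡_)

qint : ℕ → Poly
qint m = replicate m 1ℚ

-- compositions of n into r positive parts

comps : ℕ → ℕ → List (List ℕ)
comps zero zero = [] ∷ []
comps zero (suc n) = []
comps (suc r) n = concatMap (λ m → map (m ∷_) (comps r (n ∸ m))) (map suc (upTo n))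

sumₚ : List Poly → Poly
sumₚ = foldr _+ₚ_ []

prodₚ : List Poly → Poly
prodₚ = foldr _*ₚ_ oneₚ

-- ω_p(k; ζ_p), computed in ℚ[q]/Φ_p using a family u with u m = [m]^{-1}
-- (only u m for 1 ≤ m < p is used)
ωζ : ℕ → List ℕ → (ℕ → Poly) → Poly
ωζ p k u = sumₚ (map (λ ms → prodₚ (zipWith (λ ka m → xpow ((ka ∸ 1) ℕ.* m) *ₚ (u m ^ₚ ka)) k ms))
                     (comps (length k) p))

IsInvFamily : ℕ → (ℕ → Poly) → Set
IsInvFamily p u = ∀ m → 1 ℕ.≤ m → m ℕ.< p → (u m *ₚ qint m) ≈[ p ] oneₚ

Represents : ℕ → List ℕ → List ℤ → Set
Represents p k f = Σ (ℕ → Poly) (λ u → IsInvFamily p u × (intPoly f ≈[ p ] ωζ p k u))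

-- 1/d for d > 0 (never applied to 0 below; 1/0 := 0 as a convention)
recipℕ : ℕ → ℚ
recipℕ zero = 0ℚ
recipℕ (suc d) = (+ 1) ℚ./ suc d

ωℚ : ℕ → List ℕ → ℚ
ωℚ n k = foldr ℚ._+_ 0ℚ
  (map (λ ms → recipℕ (foldr ℕ._*_ 1 (zipWith (λ ka m → m ℕ.^ ka) k ms))) (comps (length k) n))

-- a ≡ x (mod p) in 𝔽_p, for a ∈ ℤ and x ∈ ℚ reduced mod p
-- (with the convention that x reduces to 0 when p divides its denominator)
RedEq : ℕ → ℤ → ℚ → Set
RedEq p a x = ((+ p) ℤd.∣ (↧ x) → (+ p) ℤd.∣ a)
            × (¬ ((+ p) ℤd.∣ (↧ x)) → (+ p) ℤd.∣ (a ℤ.* (↧ x) ℤ.- (↥ x)))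

module Submission where

open import Defs
open import Data.Nat using (ℕ; _≤_; _<_)
open import Data.Integer using (ℤ)
open import Data.List using (List; length)
open import Data.List.Relation.Unary.All using (All)
open import Data.Nat.Primality using (Prime)
open import Data.Product using (Σ; _×_)

-- Theorem 1.2 (r ≥ 2, p prime): ω_p(k; ζ_p) is integral, and modulo
-- (1 - ζ_p) it reduces to ω_p(k) mod p.  Here ℚ(ζ_p) is ℚ[q] modulo
-- Φ_p = 1 + q + ⋯ + q^(p-1), and reduction modulo (1 - ζ_p) of an integral
-- representative f is f(1) mod p.
--
-- 1. ℚ[q] is a commutative ring (PolynomialRing, with a ring solver);
--    congruence modulo any d respects the ring operations and inverses
--    modulo d are unique (Congruence).
-- 2. If m m′ ≡ 1 (mod p) then V(m) = 1 + q^m + ⋯ + q^(m(m′-1)) satisfies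
--    [m] V(m) = [m m′] ≡ 1 modulo Φ_p: an integral inverse of [m].  Computed
--    with V, ω_p(k; q) is integral with value A(k) = Σ ∏ m′_a^(k_a) at 1.
-- 3. Compositions of p into r ≥ 2 parts have all parts < p, so ω_p(k; ζ_p)
--    does not depend on the chosen inverses: any representative f is
--    congruent to the one of step 2.
-- 4. Integral polynomials congruent modulo Φ_p have values at 1 congruent
--    modulo p (ResidueSums), so f(1) ≡ A(k); termwise A(k) ≡ ω_p(k) since
--    m′ ≡ 1/m (OmegaReduction).  Hence the bound N = 0 works.

module PolynomialRing where

  open import Data.Nat using (zero; suc)
  open import Data.Rational as ℚ using (ℚ; 0ℚ; 1ℚ)
  import Data.Rational.Properties as ℚP
  open import Data.List using ([]; _∷_; map)
  open import Data.Product using (_,_)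
  open import Level using (0ℓ)
  open import Algebra.Bundles using (CommutativeMonoid; CommutativeRing)
  open import Relation.Binary.Structures using (IsEquivalence)
  import Relation.Binary.Reasoning.Setoid
  open import Relation.Binary.PropositionalEquality

  -- Two polynomials are equal when all their coefficients agree
  -- (lists may differ by trailing zeros).
  infix 4 _≋_
  record _≋_ (f g : Poly) : Set where
    constructor mk≋
    field at : ∀ i → coeff f i ≡ coeff g i
  open _≋_ public

  ≋-isEquivalence : IsEquivalence _≋_
  ≋-isEquivalence = record
    { refl  = mk≋ λ _ → refl
    ; sym   = λ e → mk≋ λ i → sym (at e i)
    ; trans = λ e e′ → mk≋ λ i → trans (at e i) (at e′ i)
    }

  coeff-+ : ∀ f g i → coeff (f +ₚ g) i ≡ coeff f i ℚ.+ coeff g i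
  coeff-+ []      g       i       = sym (ℚP.+-identityˡ (coeff g i))
  coeff-+ (a ∷ f) []      zero    = sym (ℚP.+-identityʳ a)
  coeff-+ (a ∷ f) []      (suc i) = sym (ℚP.+-identityʳ (coeff f i))
  coeff-+ (a ∷ f) (b ∷ g) zero    = refl
  coeff-+ (a ∷ f) (b ∷ g) (suc i) = coeff-+ f g i

  coeff-scale : ∀ a f i → coeff (scaleₚ a f) i ≡ a ℚ.* coeff f i
  coeff-scale a []      i       = sym (ℚP.*-zeroʳ a)
  coeff-scale a (b ∷ f) zero    = refl
  coeff-scale a (b ∷ f) (suc i) = coeff-scale a f i

  coeff-neg : ∀ f i → coeff (map ℚ.-_ f) i ≡ ℚ.- coeff f i
  coeff-neg []      i       = refl
  coeff-neg (b ∷ f) zero    = refl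
  coeff-neg (b ∷ f) (suc i) = coeff-neg f i

  open IsEquivalence ≋-isEquivalence public
    using () renaming (refl to ≋-refl; sym to ≋-sym; trans to ≋-trans)

  ≡⇒≋ : ∀ {f g} → f ≡ g → f ≋ g
  ≡⇒≋ refl = ≋-refl

  ∷-cong : ∀ {a b f g} → a ≡ b → f ≋ g → a ∷ f ≋ b ∷ g
  ∷-cong a≡b f≋g = mk≋ λ { zero → a≡b ; (suc i) → at f≋g i }

  ∷-tail : ∀ {a b f g} → a ∷ f ≋ b ∷ g → f ≋ g
  ∷-tail e = mk≋ λ i → at e (suc i)

  shift : Poly → Poly
  shift f = 0ℚ ∷ f

  shift-[] : shift [] ≋ []
  shift-[] = mk≋ λ { zero → refl ; (suc i) → refl }

  ∷-zero : ∀ {a f} → a ≡ 0ℚ → f ≋ [] → a ∷ f ≋ []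
  ∷-zero a≡0 f≋[] = ≋-trans (∷-cong a≡0 f≋[]) shift-[]

  +ₚ-cong : ∀ {f f′ g g′} → f ≋ f′ → g ≋ g′ → f +ₚ g ≋ f′ +ₚ g′
  +ₚ-cong {f} {f′} {g} {g′} e e′ = mk≋ λ i → begin
    coeff (f +ₚ g) i           ≡⟨ coeff-+ f g i ⟩
    coeff f i ℚ.+ coeff g i    ≡⟨ cong₂ ℚ._+_ (at e i) (at e′ i) ⟩
    coeff f′ i ℚ.+ coeff g′ i  ≡⟨ coeff-+ f′ g′ i ⟨
    coeff (f′ +ₚ g′) i         ∎
    where open ≡-Reasoning

  +ₚ-congʳ : ∀ f {g g′} → g ≋ g′ → f +ₚ g ≋ f +ₚ g′
  +ₚ-congʳ f = +ₚ-cong ≋-refl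

  +ₚ-identityʳ : ∀ f → f +ₚ [] ≋ f
  +ₚ-identityʳ []      = ≋-refl
  +ₚ-identityʳ (a ∷ f) = ≋-refl

  +ₚ-comm : ∀ f g → f +ₚ g ≋ g +ₚ f
  +ₚ-comm []      g       = ≋-sym (+ₚ-identityʳ g)
  +ₚ-comm (a ∷ f) []      = ≋-refl
  +ₚ-comm (a ∷ f) (b ∷ g) = ∷-cong (ℚP.+-comm a b) (+ₚ-comm f g)

  +ₚ-assoc : ∀ f g h → (f +ₚ g) +ₚ h ≋ f +ₚ (g +ₚ h)
  +ₚ-assoc []      g       h       = ≋-refl
  +ₚ-assoc (a ∷ f) []      h       = ≋-refl
  +ₚ-assoc (a ∷ f) (b ∷ g) []      = ≋-refl
  +ₚ-assoc (a ∷ f) (b ∷ g) (c ∷ h) = ∷-cong (ℚP.+-assoc a b c) (+ₚ-assoc f g h)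

  -ₚ-inverseʳ : ∀ f → f +ₚ map ℚ.-_ f ≋ []
  -ₚ-inverseʳ []      = ≋-refl
  -ₚ-inverseʳ (a ∷ f) = ∷-zero (ℚP.+-inverseʳ a) (-ₚ-inverseʳ f)

  -ₚ-cong : ∀ {f g} → f ≋ g → map ℚ.-_ f ≋ map ℚ.-_ g
  -ₚ-cong {f} {g} e = mk≋ λ i →
    trans (coeff-neg f i) (trans (cong ℚ.-_ (at e i)) (sym (coeff-neg g i)))

  scale-cong : ∀ a {f g} → f ≋ g → scaleₚ a f ≋ scaleₚ a g
  scale-cong a {f} {g} e = mk≋ λ i →
    trans (coeff-scale a f i) (trans (cong (a ℚ.*_) (at e i)) (sym (coeff-scale a g i)))

  scale-zero : ∀ f → scaleₚ 0ℚ f ≋ []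
  scale-zero []      = ≋-refl
  scale-zero (b ∷ f) = ∷-zero (ℚP.*-zeroˡ b) (scale-zero f)

  scale-one : ∀ f → scaleₚ 1ℚ f ≋ f
  scale-one []      = ≋-refl
  scale-one (b ∷ f) = ∷-cong (ℚP.*-identityˡ b) (scale-one f)

  scale-+ʳ : ∀ a f g → scaleₚ a (f +ₚ g) ≋ scaleₚ a f +ₚ scaleₚ a g
  scale-+ʳ a []      g       = ≋-refl
  scale-+ʳ a (b ∷ f) []      = ≋-refl
  scale-+ʳ a (b ∷ f) (c ∷ g) = ∷-cong (ℚP.*-distribˡ-+ a b c) (scale-+ʳ a f g)

  scale-+ˡ : ∀ a b f → scaleₚ (a ℚ.+ b) f ≋ scaleₚ a f +ₚ scaleₚ b f
  scale-+ˡ a b []      = ≋-refl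
  scale-+ˡ a b (c ∷ f) = ∷-cong (ℚP.*-distribʳ-+ c a b) (scale-+ˡ a b f)

  ℚ-interchange : ∀ x y z w → (x ℚ.+ y) ℚ.+ (z ℚ.+ w) ≡ (x ℚ.+ z) ℚ.+ (y ℚ.+ w)
  ℚ-interchange = interchange
    where open import Algebra.Properties.CommutativeSemigroup
                     (CommutativeMonoid.commutativeSemigroup ℚP.+-0-commutativeMonoid)

  +ₚ-interchange : ∀ f g h k → (f +ₚ g) +ₚ (h +ₚ k) ≋ (f +ₚ h) +ₚ (g +ₚ k)
  +ₚ-interchange f g h k = mk≋ λ i → begin
    coeff ((f +ₚ g) +ₚ (h +ₚ k)) i
      ≡⟨ trans (coeff-+ (f +ₚ g) (h +ₚ k) i) (cong₂ ℚ._+_ (coeff-+ f g i) (coeff-+ h k i)) ⟩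
    (coeff f i ℚ.+ coeff g i) ℚ.+ (coeff h i ℚ.+ coeff k i)
      ≡⟨ ℚ-interchange (coeff f i) (coeff g i) (coeff h i) (coeff k i) ⟩
    (coeff f i ℚ.+ coeff h i) ℚ.+ (coeff g i ℚ.+ coeff k i)
      ≡⟨ trans (coeff-+ (f +ₚ h) (g +ₚ k) i) (cong₂ ℚ._+_ (coeff-+ f h i) (coeff-+ g k i)) ⟨
    coeff ((f +ₚ h) +ₚ (g +ₚ k)) i ∎
    where open ≡-Reasoning

  scale-assoc : ∀ a b f → scaleₚ (a ℚ.* b) f ≋ scaleₚ a (scaleₚ b f)
  scale-assoc a b []      = ≋-refl
  scale-assoc a b (c ∷ f) = ∷-cong (ℚP.*-assoc a b c) (scale-assoc a b f)

  shift-cong : ∀ {f g} → f ≋ g → shift f ≋ shift g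
  shift-cong = ∷-cong refl

  shift-+ : ∀ f g → shift (f +ₚ g) ≋ shift f +ₚ shift g
  shift-+ f g = ∷-cong (sym (ℚP.+-identityˡ 0ℚ)) ≋-refl

  scale-shift : ∀ a f → scaleₚ a (shift f) ≋ shift (scaleₚ a f)
  scale-shift a f = ∷-cong (ℚP.*-zeroʳ a) ≋-refl

  ∷≋[]⁻¹ : ∀ {a f} → a ∷ f ≋ [] → a ≡ 0ℚ × f ≋ []
  ∷≋[]⁻¹ e = at e zero , mk≋ λ i → at e (suc i)

  *ₚ-zeroˡ : ∀ f g → f ≋ [] → f *ₚ g ≋ []
  *ₚ-zeroˡ []      g e = ≋-refl
  *ₚ-zeroˡ (a ∷ f) g e with ∷≋[]⁻¹ e
  ... | a≡0 , f≋[] = +ₚ-cong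
    (≋-trans (≡⇒≋ (cong (λ x → scaleₚ x g) a≡0)) (scale-zero g))
    (≋-trans (shift-cong (*ₚ-zeroˡ f g f≋[])) shift-[])

  *ₚ-zeroʳ : ∀ f → f *ₚ [] ≋ []
  *ₚ-zeroʳ []      = ≋-refl
  *ₚ-zeroʳ (a ∷ f) = ≋-trans (shift-cong (*ₚ-zeroʳ f)) shift-[]

  *ₚ-congˡ : ∀ {f f′} g → f ≋ f′ → f *ₚ g ≋ f′ *ₚ g
  *ₚ-congˡ {[]}    {f′}     g e = ≋-sym (*ₚ-zeroˡ f′ g (≋-sym e))
  *ₚ-congˡ {a ∷ f} {[]}     g e = *ₚ-zeroˡ (a ∷ f) g e
  *ₚ-congˡ {a ∷ f} {b ∷ f′} g e = +ₚ-cong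
    (≡⇒≋ (cong (λ x → scaleₚ x g) (at e zero)))
    (shift-cong (*ₚ-congˡ g (∷-tail e)))

  *ₚ-congʳ : ∀ f {g g′} → g ≋ g′ → f *ₚ g ≋ f *ₚ g′
  *ₚ-congʳ []      e = ≋-refl
  *ₚ-congʳ (a ∷ f) e = +ₚ-cong (scale-cong a e) (shift-cong (*ₚ-congʳ f e))

  *ₚ-cong : ∀ {f f′ g g′} → f ≋ f′ → g ≋ g′ → f *ₚ g ≋ f′ *ₚ g′
  *ₚ-cong {f′ = f′} {g = g} e e′ = ≋-trans (*ₚ-congˡ g e) (*ₚ-congʳ f′ e′)

  scale-*ₚ : ∀ a f g → scaleₚ a f *ₚ g ≋ scaleₚ a (f *ₚ g)
  scale-*ₚ a []      g = ≋-refl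
  scale-*ₚ a (b ∷ f) g = ≋-trans
    (+ₚ-cong (scale-assoc a b g) (shift-cong (scale-*ₚ a f g)))
    (≋-sym (≋-trans (scale-+ʳ a (scaleₚ b g) (shift (f *ₚ g)))
                    (+ₚ-cong ≋-refl (scale-shift a (f *ₚ g)))))

  shift-*ₚ : ∀ f g → shift f *ₚ g ≋ shift (f *ₚ g)
  shift-*ₚ f g = +ₚ-cong (scale-zero g) ≋-refl

  *ₚ-distribʳ : ∀ f f′ g → (f +ₚ f′) *ₚ g ≋ f *ₚ g +ₚ f′ *ₚ g
  *ₚ-distribʳ []      f′       g = ≋-refl
  *ₚ-distribʳ (a ∷ f) []       g = ≋-sym (+ₚ-identityʳ ((a ∷ f) *ₚ g))
  *ₚ-distribʳ (a ∷ f) (b ∷ f′) g = ≋-trans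
    (+ₚ-cong (scale-+ˡ a b g)
             (≋-trans (shift-cong (*ₚ-distribʳ f f′ g)) (shift-+ (f *ₚ g) (f′ *ₚ g))))
    (+ₚ-interchange (scaleₚ a g) (scaleₚ b g) (shift (f *ₚ g)) (shift (f′ *ₚ g)))

  *ₚ-assoc : ∀ f g h → (f *ₚ g) *ₚ h ≋ f *ₚ (g *ₚ h)
  *ₚ-assoc []      g h = ≋-refl
  *ₚ-assoc (a ∷ f) g h = ≋-trans (*ₚ-distribʳ (scaleₚ a g) (shift (f *ₚ g)) h)
    (+ₚ-cong (scale-*ₚ a g h)
             (≋-trans (shift-*ₚ (f *ₚ g) h) (shift-cong (*ₚ-assoc f g h))))

  *ₚ-∷ : ∀ g a f → g *ₚ (a ∷ f) ≋ scaleₚ a g +ₚ shift (g *ₚ f)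
  *ₚ-∷ []      a f = ≋-sym shift-[]
  *ₚ-∷ (b ∷ g) a f = ∷-cong
    (trans (ℚP.+-identityʳ (b ℚ.* a)) (trans (ℚP.*-comm b a) (sym (ℚP.+-identityʳ (a ℚ.* b)))))
    (≋-trans (+ₚ-cong ≋-refl (*ₚ-∷ g a f))
    (≋-trans (≋-sym (+ₚ-assoc (scaleₚ b f) (scaleₚ a g) (shift (g *ₚ f))))
    (≋-trans (+ₚ-cong (+ₚ-comm (scaleₚ b f) (scaleₚ a g)) ≋-refl)
             (+ₚ-assoc (scaleₚ a g) (scaleₚ b f) (shift (g *ₚ f))))))

  *ₚ-comm : ∀ f g → f *ₚ g ≋ g *ₚ f
  *ₚ-comm []      g = ≋-sym (*ₚ-zeroʳ g)
  *ₚ-comm (a ∷ f) g = ≋-sym (≋-trans (*ₚ-∷ g a f) (+ₚ-cong ≋-refl (shift-cong (*ₚ-comm g f))))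

  *ₚ-identityˡ : ∀ f → oneₚ *ₚ f ≋ f
  *ₚ-identityˡ f = ≋-trans (+ₚ-cong (scale-one f) shift-[]) (+ₚ-identityʳ f)

  polyCommutativeRing : CommutativeRing 0ℓ 0ℓ
  polyCommutativeRing = record
    { Carrier = Poly
    ; _≈_ = _≋_
    ; _+_ = _+ₚ_
    ; _*_ = _*ₚ_
    ; -_  = map (ℚ.-_)
    ; 0#  = []
    ; 1#  = oneₚ
    ; isCommutativeRing = record
      { isRing = record
        { +-isAbelianGroup = record
          { isGroup = record
            { isMonoid = record
              { isSemigroup = record
                { isMagma = record { isEquivalence = ≋-isEquivalence ; ∙-cong = +ₚ-cong }
                ; assoc = +ₚ-assoc }
              ; identity = (λ _ → ≋-refl) , +ₚ-identityʳ }
            ; inverse = (λ f → ≋-trans (+ₚ-comm (map ℚ.-_ f) f) (-ₚ-inverseʳ f)) , -ₚ-inverseʳ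
            ; ⁻¹-cong = -ₚ-cong }
          ; comm = +ₚ-comm }
        ; *-cong = *ₚ-cong
        ; *-assoc = *ₚ-assoc
        ; *-identity = *ₚ-identityˡ , λ f → ≋-trans (*ₚ-comm f oneₚ) (*ₚ-identityˡ f)
        ; distrib = (λ f g h → ≋-trans (*ₚ-comm f (g +ₚ h))
                      (≋-trans (*ₚ-distribʳ g h f) (+ₚ-cong (*ₚ-comm g f) (*ₚ-comm h f))))
                  , (λ h f g → *ₚ-distribʳ f g h) }
      ; *-comm = *ₚ-comm }
    }

  module ≋-Reasoning = Relation.Binary.Reasoning.Setoid (CommutativeRing.setoid polyCommutativeRing)

module PolySolver where
  open import Algebra.Solver.Ring.AlmostCommutativeRing
    using (AlmostCommutativeRing; fromCommutativeRing; _-Raw-AlmostCommutative⟶_)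
  open import Data.Rational as ℚ using (ℚ)
  import Data.Rational.Properties as ℚP
  open import Data.List using ([]; _∷_)
  open import Relation.Binary.PropositionalEquality using (refl; sym)
  open import Data.Maybe using (Maybe; just; nothing)
  open import Relation.Nullary using (yes; no)
  open PolynomialRing

  private
    polyRing : AlmostCommutativeRing _ _
    polyRing = fromCommutativeRing polyCommutativeRing

    constant : ℚP.+-*-rawRing -Raw-AlmostCommutative⟶ polyRing
    constant = record
      { ⟦_⟧    = λ a → a ∷ []
      ; +-homo = λ a b → ≋-refl
      ; *-homo = λ a b → ∷-cong (sym (ℚP.+-identityʳ (a ℚ.* b))) ≋-refl
      ; -‿homo = λ a → ≋-refl
      ; 0-homo = shift-[]
      ; 1-homo = ≋-refl
      }

    constant-≟ : ∀ a b → Maybe ((a ∷ []) ≋ (b ∷ []))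
    constant-≟ a b with a ℚP.≟ b
    ... | yes refl = just ≋-refl
    ... | no _     = nothing

  open import Algebra.Solver.Ring ℚP.+-*-rawRing polyRing constant constant-≟ public


-- Congruence modulo a fixed polynomial d: the relation of the quotient
-- ring ℚ[q]/(d).  For d = Φ_p this is equality in ℚ(ζ_p).
module Congruence (d : Poly) where

  open import Data.Nat using (zero; suc)
  open import Data.List using ([]; map)
  open import Data.List.Relation.Unary.All using (All; []; _∷_)
  open import Relation.Binary.Bundles using (Setoid)
  open import Relation.Binary.Structures using (IsEquivalence)
  open PolynomialRing
  open PolySolver using (solve; _:=_; _:+_; _:*_; _:-_; :-_; con)
  open import Data.Rational as ℚ using (1ℚ)
  import Relation.Binary.Reasoning.Setoid

  infix 4 _≈ₘ_
  infixr 4 _,_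
  record _≈ₘ_ (f g : Poly) : Set where
    constructor _,_
    field
      quotient   : Poly
      divisible  : f -ₚ g ≋ quotient *ₚ d

  ≋⇒≈ₘ : ∀ {f g} → f ≋ g → f ≈ₘ g
  ≋⇒≈ₘ {f} {g} f≋g = [] , (begin
    f -ₚ g  ≈⟨ +ₚ-cong f≋g ≋-refl ⟩
    g -ₚ g  ≈⟨ -ₚ-inverseʳ g ⟩
    []      ∎)
    where open ≋-Reasoning

  ≈ₘ-refl : ∀ {f} → f ≈ₘ f
  ≈ₘ-refl = ≋⇒≈ₘ ≋-refl

  ≈ₘ-sym : ∀ {f g} → f ≈ₘ g → g ≈ₘ f
  ≈ₘ-sym {f} {g} (h , e) = map (ℚ.-_) h , (begin
    g -ₚ f           ≈⟨ solve 2 (λ f g → g :- f := :- (f :- g)) ≋-refl f g ⟩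
    map (ℚ.-_) (f -ₚ g) ≈⟨ -ₚ-cong e ⟩
    map (ℚ.-_) (h *ₚ d) ≈⟨ solve 2 (λ h d → :- (h :* d) := (:- h) :* d) ≋-refl h d ⟩
    map (ℚ.-_) h *ₚ d ∎)
    where open ≋-Reasoning

  ≈ₘ-trans : ∀ {f g k} → f ≈ₘ g → g ≈ₘ k → f ≈ₘ k
  ≈ₘ-trans {f} {g} {k} (h , e) (h′ , e′) = h +ₚ h′ , (begin
    f -ₚ k                   ≈⟨ solve 3 (λ f g k → f :- k := (f :- g) :+ (g :- k)) ≋-refl f g k ⟩
    (f -ₚ g) +ₚ (g -ₚ k)     ≈⟨ +ₚ-cong e e′ ⟩
    h *ₚ d +ₚ h′ *ₚ d        ≈⟨ solve 3 (λ h h′ d → h :* d :+ h′ :* d := (h :+ h′) :* d) ≋-refl h h′ d ⟩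
    (h +ₚ h′) *ₚ d           ∎)
    where open ≋-Reasoning

  ≈ₘ-isEquivalence : IsEquivalence _≈ₘ_
  ≈ₘ-isEquivalence = record { refl = ≈ₘ-refl ; sym = ≈ₘ-sym ; trans = ≈ₘ-trans }

  +ₚ-congₘ : ∀ {f f′ g g′} → f ≈ₘ g → f′ ≈ₘ g′ → f +ₚ f′ ≈ₘ g +ₚ g′
  +ₚ-congₘ {f} {f′} {g} {g′} (h , e) (h′ , e′) = h +ₚ h′ , (begin
    (f +ₚ f′) -ₚ (g +ₚ g′)
      ≈⟨ solve 4 (λ f f′ g g′ → (f :+ f′) :- (g :+ g′) := (f :- g) :+ (f′ :- g′)) ≋-refl f f′ g g′ ⟩
    (f -ₚ g) +ₚ (f′ -ₚ g′)  ≈⟨ +ₚ-cong e e′ ⟩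
    h *ₚ d +ₚ h′ *ₚ d       ≈⟨ solve 3 (λ h h′ d → h :* d :+ h′ :* d := (h :+ h′) :* d) ≋-refl h h′ d ⟩
    (h +ₚ h′) *ₚ d          ∎)
    where open ≋-Reasoning

  *ₚ-congₘ : ∀ {f f′ g g′} → f ≈ₘ g → f′ ≈ₘ g′ → f *ₚ f′ ≈ₘ g *ₚ g′
  *ₚ-congₘ {f} {f′} {g} {g′} (h , e) (h′ , e′) = h *ₚ f′ +ₚ g *ₚ h′ , (begin
    f *ₚ f′ -ₚ g *ₚ g′
      ≈⟨ solve 4 (λ f f′ g g′ → f :* f′ :- g :* g′ := (f :- g) :* f′ :+ g :* (f′ :- g′)) ≋-refl f f′ g g′ ⟩
    (f -ₚ g) *ₚ f′ +ₚ g *ₚ (f′ -ₚ g′) ≈⟨ +ₚ-cong (*ₚ-congˡ f′ e) (*ₚ-congʳ g e′) ⟩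
    (h *ₚ d) *ₚ f′ +ₚ g *ₚ (h′ *ₚ d)
      ≈⟨ solve 5 (λ h f′ g h′ d → (h :* d) :* f′ :+ g :* (h′ :* d) := (h :* f′ :+ g :* h′) :* d) ≋-refl h f′ g h′ d ⟩
    (h *ₚ f′ +ₚ g *ₚ h′) *ₚ d         ∎)
    where open ≋-Reasoning

  ^ₚ-congₘ : ∀ {f g} n → f ≈ₘ g → f ^ₚ n ≈ₘ g ^ₚ n
  ^ₚ-congₘ zero    e = ≈ₘ-refl
  ^ₚ-congₘ (suc n) e = *ₚ-congₘ e (^ₚ-congₘ n e)

  sumₚ-congₘ : ∀ {A : Set} {F G : A → Poly} {xs : List A} →
    All (λ x → F x ≈ₘ G x) xs → sumₚ (map F xs) ≈ₘ sumₚ (map G xs)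
  sumₚ-congₘ []       = ≈ₘ-refl
  sumₚ-congₘ (e ∷ es) = +ₚ-congₘ e (sumₚ-congₘ es)

  ≈ₘ-setoid : Setoid _ _
  ≈ₘ-setoid = record { isEquivalence = ≈ₘ-isEquivalence }

  module ≈ₘ-Reasoning = Relation.Binary.Reasoning.Setoid ≈ₘ-setoid

  inverse-unique : ∀ {a b c} → a *ₚ c ≈ₘ oneₚ → b *ₚ c ≈ₘ oneₚ → a ≈ₘ b
  inverse-unique {a} {b} {c} ac≈1 bc≈1 = begin
    a                 ≈⟨ ≋⇒≈ₘ (solve 1 (λ a → a := a :* con 1ℚ) ≋-refl a) ⟩
    a *ₚ oneₚ         ≈⟨ *ₚ-congₘ (≈ₘ-refl {a}) (≈ₘ-sym bc≈1) ⟩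
    a *ₚ (b *ₚ c)     ≈⟨ ≋⇒≈ₘ (solve 3 (λ a b c → a :* (b :* c) := (a :* c) :* b) ≋-refl a b c) ⟩
    (a *ₚ c) *ₚ b     ≈⟨ *ₚ-congₘ ac≈1 (≈ₘ-refl {b}) ⟩
    oneₚ *ₚ b         ≈⟨ ≋⇒≈ₘ (*ₚ-identityˡ b) ⟩
    b                 ∎
    where open ≈ₘ-Reasoning

-- The q-integers [n] = 1 + q + ⋯ + q^(n-1) and the geometric sums
-- 1 + q^m + ⋯ + q^(m(j-1)); the key fact is [1 + p t] ≡ 1 modulo Φ_p = [p].
module QIntegers where

  open import Data.Nat using (zero; suc; _+_; _*_)
  import Data.Nat.Properties as ℕP
  open import Data.Rational using (1ℚ)
  import Data.Rational.Properties as ℚP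
  open import Data.List using ([]; _∷_)
  open import Relation.Binary.PropositionalEquality using (subst; sym)
  open PolynomialRing
  open PolySolver using (solve; _:=_; _:+_; _:*_; con)

  qint-+ : ∀ a b → qint (a + b) ≋ qint a +ₚ xpow a *ₚ qint b
  qint-+ zero    b = ≋-sym (*ₚ-identityˡ (qint b))
  qint-+ (suc a) b = ≋-trans (∷-cong (sym (ℚP.+-identityʳ 1ℚ)) (qint-+ a b))
    (+ₚ-congʳ (qint (suc a)) (≋-sym (shift-*ₚ (xpow a) (qint b))))

  geometric : ℕ → ℕ → Poly
  geometric m zero    = []
  geometric m (suc j) = oneₚ +ₚ xpow m *ₚ geometric m j

  qint-*-geometric : ∀ m j → qint m *ₚ geometric m j ≋ qint (m * j)
  qint-*-geometric m zero    = subst (λ n → qint m *ₚ [] ≋ qint n) (sym (ℕP.*-zeroʳ m)) (*ₚ-zeroʳ (qint m))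
  qint-*-geometric m (suc j) = subst (λ n → qint m *ₚ geometric m (suc j) ≋ qint n) (sym (ℕP.*-suc m j)) (begin
    qint m *ₚ (oneₚ +ₚ xpow m *ₚ geometric m j)
      ≈⟨ solve 3 (λ Q X G → Q :* (con 1ℚ :+ X :* G) := Q :+ X :* (Q :* G)) ≋-refl (qint m) (xpow m) (geometric m j) ⟩
    qint m +ₚ xpow m *ₚ (qint m *ₚ geometric m j)     ≈⟨ +ₚ-cong ≋-refl (*ₚ-congʳ (xpow m) (qint-*-geometric m j)) ⟩
    qint m +ₚ xpow m *ₚ qint (m * j)                  ≈⟨ qint-+ m (m * j) ⟨
    qint (m + m * j)                                  ∎)
    where open ≋-Reasoning

  module _ (p : ℕ) where
    open Congruence (Φ p)

    -- [p t] = [p] (1 + q^p + ⋯ + q^(p(t-1))) is a multiple of Φ_p = [p] …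
    qint-p*t≈0 : ∀ t → qint (p * t) ≈ₘ []
    qint-p*t≈0 t = geometric p t , (begin
      qint (p * t) -ₚ []        ≈⟨ +ₚ-identityʳ (qint (p * t)) ⟩
      qint (p * t)              ≈⟨ qint-*-geometric p t ⟨
      Φ p *ₚ geometric p t      ≈⟨ *ₚ-comm (Φ p) (geometric p t) ⟩
      geometric p t *ₚ Φ p      ∎)
      where open ≋-Reasoning

    -- … so [1 + p t] = 1 + q [p t] ≡ 1 modulo Φ_p.
    qint-1+p*t : ∀ t → qint (1 + p * t) ≈ₘ oneₚ
    qint-1+p*t t = begin
      qint (1 + p * t)                  ≈⟨ ≋⇒≈ₘ (qint-+ 1 (p * t)) ⟩
      oneₚ +ₚ xpow 1 *ₚ qint (p * t)    ≈⟨ +ₚ-congₘ (≈ₘ-refl {oneₚ}) (*ₚ-congₘ (≈ₘ-refl {xpow 1}) (qint-p*t≈0 t)) ⟩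
      oneₚ +ₚ xpow 1 *ₚ []              ≈⟨ ≋⇒≈ₘ (≋-trans (+ₚ-congʳ oneₚ (*ₚ-zeroʳ (xpow 1))) (+ₚ-identityʳ oneₚ)) ⟩
      oneₚ                              ∎
      where open ≈ₘ-Reasoning

-- Inverses modulo a prime p, from Bézout's identity.
module ModularInverse where

  open import Data.Nat using (zero; suc; _+_; _*_; NonZero; _<?_)
  import Data.Nat.Properties as ℕP
  open import Data.Nat.Coprimality using (prime⇒coprime; coprime-Bézout)
  import Data.Nat.Coprimality as Coprime
  open import Data.Nat.GCD using (module Bézout)
  open import Data.Product using (_,_; proj₁; proj₂)
  open import Relation.Binary.PropositionalEquality
  open import Relation.Nullary using (yes; no; contradiction)
  open import Data.Nat.Solver using (module +-*-Solver)
  open +-*-Solver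

  OneMod : ℕ → ℕ → Set
  OneMod p n = Σ ℕ λ t → n ≡ 1 + p * t

  oneMod-* : ∀ {p a b} → OneMod p a → OneMod p b → OneMod p (a * b)
  oneMod-* {p} (s , refl) (t , refl) = s + t + p * s * t ,
    solve 3 (λ p s t → (con 1 :+ p :* s) :* (con 1 :+ p :* t) := con 1 :+ p :* (s :+ t :+ p :* s :* t)) refl p s t

  -- If 1 + x m is a multiple of p then x (p - 1) is an inverse of m.
  -- Written with p = 2 + p₂ and 1 + x m = (1 + y) p.
  negated-inverse : ∀ m x y p₂ → 1 + x * m ≡ suc y * (2 + p₂) →
    OneMod (2 + p₂) (m * (x * suc p₂))
  negated-inverse m x y p₂ eq = p₂ + y * suc p₂ , ℕP.+-cancelʳ-≡ _ _ _ (begin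
    m * (x * suc p₂) + (2 + p₂)
      ≡⟨ solve 3 (λ m x p → m :* (x :* (con 1 :+ p)) :+ (con 2 :+ p)
                         := (con 1 :+ x :* m) :* (con 1 :+ p) :+ con 1) refl m x p₂ ⟩
    (1 + x * m) * suc p₂ + 1                  ≡⟨ cong (λ n → n * suc p₂ + 1) eq ⟩
    (suc y * (2 + p₂)) * suc p₂ + 1
      ≡⟨ solve 2 (λ y p → ((con 1 :+ y) :* (con 2 :+ p)) :* (con 1 :+ p) :+ con 1
                       := (con 1 :+ (con 2 :+ p) :* (p :+ y :* (con 1 :+ p))) :+ (con 2 :+ p)) refl y p₂ ⟩
    1 + (2 + p₂) * (p₂ + y * suc p₂) + (2 + p₂) ∎)
    where open ≡-Reasoning

  modularInverse : ∀ {p} → Prime p → ∀ m → .{{NonZero m}} → m < p → Σ ℕ λ m′ → OneMod p (m * m′)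
  modularInverse {p} pp m m<p with coprime-Bézout (Coprime.sym (prime⇒coprime pp m<p))
  ... | Bézout.+- x y eq = x , y , trans (ℕP.*-comm m x) (trans (sym eq) (cong (1 +_) (ℕP.*-comm y p)))
  ... | Bézout.-+ x zero ()
  ... | Bézout.-+ x (suc y) eq with p | pp
  -- p ≥ 2, being prime.
  ...   | suc (suc p₂) | _ = x * suc p₂ , negated-inverse m x y p₂ eq

  -- A total choice of inverses, correct on 1 ≤ m < p.
  inverseMod : ∀ {p} → Prime p → ℕ → ℕ
  inverseMod {p} pp zero = 0
  inverseMod {p} pp (suc m) with suc m <? p
  ... | yes m<p = proj₁ (modularInverse pp (suc m) m<p)
  ... | no  _   = 0

  inverseMod-correct : ∀ {p} (pp : Prime p) m → 1 ≤ m → m < p → OneMod p (m * inverseMod pp m)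
  inverseMod-correct {p} pp (suc m) _ m<p with suc m <? p
  ... | yes m<p′ = proj₂ (modularInverse pp (suc m) m<p′)
  ... | no ¬m<p  = contradiction m<p ¬m<p

module IntegerEmbedding where

  open import Data.Integer as ℤ using (+_)
  import Data.Integer.Properties as ℤP
  open import Data.Rational as ℚ using (ℚ; toℚᵘ)
  import Data.Rational.Properties as ℚP
  open import Data.Rational.Unnormalised as ℚᵘ using (mkℚᵘ; *≡*)
  import Data.Rational.Unnormalised.Properties as ℚᵘP
  open import Relation.Binary.PropositionalEquality
  open import Data.Integer.Solver using (module +-*-Solver)
  open +-*-Solver

  infix 8 _/1
  _/1 : ℤ → ℚ
  z /1 = z ℚ./ 1

  private
    /1≃ : ∀ z → toℚᵘ (z /1) ℚᵘ.≃ mkℚᵘ z 0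
    /1≃ z = ℚP.toℚᵘ-fromℚᵘ (mkℚᵘ z 0)

  /1-+ : ∀ a b → (a ℤ.+ b) /1 ≡ a /1 ℚ.+ b /1
  /1-+ a b = ℚP.toℚᵘ-injective (ℚᵘP.≃-trans (/1≃ (a ℤ.+ b))
    (ℚᵘP.≃-trans (*≡* (solve 2 (λ a b → (a :+ b) :* con (+ 1) := (a :* con (+ 1) :+ b :* con (+ 1)) :* con (+ 1)) refl a b))
    (ℚᵘP.≃-trans (ℚᵘP.+-cong (ℚᵘP.≃-sym (/1≃ a)) (ℚᵘP.≃-sym (/1≃ b)))
                 (ℚᵘP.≃-sym (ℚP.toℚᵘ-homo-+ (a /1) (b /1))))))

  /1-* : ∀ a b → (a ℤ.* b) /1 ≡ a /1 ℚ.* b /1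
  /1-* a b = ℚP.toℚᵘ-injective (ℚᵘP.≃-trans (/1≃ (a ℤ.* b))
    (ℚᵘP.≃-trans (ℚᵘP.*-cong (ℚᵘP.≃-sym (/1≃ a)) (ℚᵘP.≃-sym (/1≃ b)))
                 (ℚᵘP.≃-sym (ℚP.toℚᵘ-homo-* (a /1) (b /1)))))

  /1-neg : ∀ a → (ℤ.- a) /1 ≡ ℚ.- (a /1)
  /1-neg a = ℚP.toℚᵘ-injective (ℚᵘP.≃-trans (/1≃ (ℤ.- a))
    (ℚᵘP.≃-sym (ℚᵘP.≃-trans (ℚP.toℚᵘ-homo‿- (a /1)) (ℚᵘP.-‿cong (/1≃ a)))))

  /1-injective : ∀ a b → a /1 ≡ b /1 → a ≡ b
  /1-injective a b e with ℚᵘP.≃-trans (ℚᵘP.≃-sym (/1≃ a)) (ℚᵘP.≃-trans (ℚP.toℚᵘ-cong e) (/1≃ b))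
  ... | *≡* eq = trans (sym (ℤP.*-identityʳ a)) (trans eq (ℤP.*-identityʳ b))

module IntegralPolynomials where

  open import Data.Nat using (zero; suc)
  open import Data.Integer as ℤ using (+_)
  open import Data.Rational as ℚ using (ℚ; 0ℚ)
  open import Data.List using ([]; _∷_; map)
  open import Data.List.Relation.Unary.All using ([]; _∷_)
  open import Data.Product using (_,_)
  open import Relation.Binary.PropositionalEquality
  open IntegerEmbedding

  IsIntegral : ℚ → Set
  IsIntegral x = Σ ℤ λ z → x ≡ z /1

  isIntegral-0 : IsIntegral 0ℚ
  isIntegral-0 = + 0 , refl

  isIntegral-+ : ∀ {x y} → IsIntegral x → IsIntegral y → IsIntegral (x ℚ.+ y)
  isIntegral-+ (a , refl) (b , refl) = a ℤ.+ b , sym (/1-+ a b)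

  isIntegral-* : ∀ {x y} → IsIntegral x → IsIntegral y → IsIntegral (x ℚ.* y)
  isIntegral-* (a , refl) (b , refl) = a ℤ.* b , sym (/1-* a b)

  isIntegral-neg : ∀ {x} → IsIntegral x → IsIntegral (ℚ.- x)
  isIntegral-neg (a , refl) = ℤ.- a , sym (/1-neg a)

  Integral : Poly → Set
  Integral = All IsIntegral

  integral-+ₚ : ∀ {f g} → Integral f → Integral g → Integral (f +ₚ g)
  integral-+ₚ []       Ig       = Ig
  integral-+ₚ (a ∷ If) []       = a ∷ If
  integral-+ₚ (a ∷ If) (b ∷ Ig) = isIntegral-+ a b ∷ integral-+ₚ If Ig

  integral-scale : ∀ {c g} → IsIntegral c → Integral g → Integral (scaleₚ c g)
  integral-scale Ic []       = []
  integral-scale Ic (b ∷ Ig) = isIntegral-* Ic b ∷ integral-scale Ic Ig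

  integral-*ₚ : ∀ {f g} → Integral f → Integral g → Integral (f *ₚ g)
  integral-*ₚ []       Ig = []
  integral-*ₚ (a ∷ If) Ig = integral-+ₚ (integral-scale a Ig) (isIntegral-0 ∷ integral-*ₚ If Ig)

  integral-neg : ∀ {f} → Integral f → Integral (map ℚ.-_ f)
  integral-neg []       = []
  integral-neg (a ∷ If) = isIntegral-neg a ∷ integral-neg If

  integral-one : Integral oneₚ
  integral-one = (+ 1 , refl) ∷ []

  integral-^ₚ : ∀ {f} n → Integral f → Integral (f ^ₚ n)
  integral-^ₚ zero    If = integral-one
  integral-^ₚ (suc n) If = integral-*ₚ If (integral-^ₚ n If)

  integral-xpow : ∀ n → Integral (xpow n)
  integral-xpow zero    = integral-one
  integral-xpow (suc n) = isIntegral-0 ∷ integral-xpow n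

  integral-intPoly : ∀ f → Integral (intPoly f)
  integral-intPoly []      = []
  integral-intPoly (z ∷ f) = (z , refl) ∷ integral-intPoly f

  toℤPoly : ∀ {f} → Integral f → List ℤ
  toℤPoly []             = []
  toℤPoly ((z , _) ∷ If) = z ∷ toℤPoly If

  intPoly-toℤPoly : ∀ {f} (If : Integral f) → intPoly (toℤPoly If) ≡ f
  intPoly-toℤPoly []              = refl
  intPoly-toℤPoly ((z , e) ∷ If) = cong₂ _∷_ (sym e) (intPoly-toℤPoly If)

module ValueAtOne where

  open import Data.Nat as ℕ using (zero; suc)
  open import Data.Integer using (+_)
  import Data.Integer.Properties as ℤP
  open import Data.Rational as ℚ using (ℚ; 0ℚ; 1ℚ)
  import Data.Rational.Properties as ℚP
  open import Data.List using ([]; _∷_; map; foldr)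
  open import Data.Product using (_,_)
  open import Relation.Binary.PropositionalEquality
  open PolynomialRing
  open IntegerEmbedding
  open QIntegers using (geometric)

  ev : Poly → ℚ
  ev = foldr ℚ._+_ 0ℚ

  ev-+ : ∀ f g → ev (f +ₚ g) ≡ ev f ℚ.+ ev g
  ev-+ []      g       = sym (ℚP.+-identityˡ (ev g))
  ev-+ (a ∷ f) []      = sym (ℚP.+-identityʳ (a ℚ.+ ev f))
  ev-+ (a ∷ f) (b ∷ g) = trans (cong ((a ℚ.+ b) ℚ.+_) (ev-+ f g)) (ℚ-interchange a b (ev f) (ev g))

  ev-scale : ∀ c g → ev (scaleₚ c g) ≡ c ℚ.* ev g
  ev-scale c []      = sym (ℚP.*-zeroʳ c)
  ev-scale c (b ∷ g) = trans (cong (c ℚ.* b ℚ.+_) (ev-scale c g)) (sym (ℚP.*-distribˡ-+ c b (ev g)))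

  ev-* : ∀ f g → ev (f *ₚ g) ≡ ev f ℚ.* ev g
  ev-* []      g = sym (ℚP.*-zeroˡ (ev g))
  ev-* (a ∷ f) g = begin
    ev (scaleₚ a g +ₚ shift (f *ₚ g))  ≡⟨ ev-+ (scaleₚ a g) (shift (f *ₚ g)) ⟩
    ev (scaleₚ a g) ℚ.+ (0ℚ ℚ.+ ev (f *ₚ g))
      ≡⟨ cong₂ ℚ._+_ (ev-scale a g) (trans (ℚP.+-identityˡ _) (ev-* f g)) ⟩
    a ℚ.* ev g ℚ.+ ev f ℚ.* ev g       ≡⟨ ℚP.*-distribʳ-+ (ev g) a (ev f) ⟨
    (a ℚ.+ ev f) ℚ.* ev g              ∎
    where open ≡-Reasoning

  ev-neg : ∀ f → ev (map ℚ.-_ f) ≡ ℚ.- ev f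
  ev-neg []      = refl
  ev-neg (a ∷ f) = trans (cong (ℚ.- a ℚ.+_) (ev-neg f)) (sym (ℚP.neg-distrib-+ a (ev f)))

  ev-≋[] : ∀ f → f ≋ [] → ev f ≡ 0ℚ
  ev-≋[] []      e = refl
  ev-≋[] (a ∷ f) e with ∷≋[]⁻¹ e
  ... | a≡0 , f≋[] = trans (cong₂ ℚ._+_ a≡0 (ev-≋[] f f≋[])) (ℚP.+-identityˡ 0ℚ)

  ev-cong : ∀ {f g} → f ≋ g → ev f ≡ ev g
  ev-cong {[]}    {g}     e = sym (ev-≋[] g (≋-sym e))
  ev-cong {a ∷ f} {[]}    e = ev-≋[] (a ∷ f) e
  ev-cong {a ∷ f} {b ∷ g} e = cong₂ ℚ._+_ (at e zero) (ev-cong (∷-tail e))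

  ℕ/1-+ : ∀ a b → (+ (a ℕ.+ b)) /1 ≡ (+ a) /1 ℚ.+ (+ b) /1
  ℕ/1-+ a b = trans (cong _/1 (ℤP.pos-+ a b)) (/1-+ (+ a) (+ b))

  ℕ/1-* : ∀ a b → (+ (a ℕ.* b)) /1 ≡ (+ a) /1 ℚ.* (+ b) /1
  ℕ/1-* a b = trans (cong _/1 (ℤP.pos-* a b)) (/1-* (+ a) (+ b))

  ev-^ₚ : ∀ f n k → ev f ≡ (+ n) /1 → ev (f ^ₚ k) ≡ (+ (n ℕ.^ k)) /1
  ev-^ₚ f n zero    e = ℚP.+-identityʳ 1ℚ
  ev-^ₚ f n (suc k) e = trans (ev-* f (f ^ₚ k))
    (trans (cong₂ ℚ._*_ e (ev-^ₚ f n k e)) (sym (ℕ/1-* n (n ℕ.^ k))))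

  ev-xpow : ∀ n → ev (xpow n) ≡ 1ℚ
  ev-xpow zero    = ℚP.+-identityʳ 1ℚ
  ev-xpow (suc n) = trans (ℚP.+-identityˡ _) (ev-xpow n)

  ev-qint : ∀ n → ev (qint n) ≡ (+ n) /1
  ev-qint zero    = refl
  ev-qint (suc n) = trans (cong (1ℚ ℚ.+_) (ev-qint n)) (sym (/1-+ (+ 1) (+ n)))

  ev-geometric : ∀ m j → ev (geometric m j) ≡ (+ j) /1
  ev-geometric m zero    = refl
  ev-geometric m (suc j) = begin
    ev (oneₚ +ₚ xpow m *ₚ geometric m j)       ≡⟨ ev-+ oneₚ (xpow m *ₚ geometric m j) ⟩
    ev oneₚ ℚ.+ ev (xpow m *ₚ geometric m j)   ≡⟨ cong (ev oneₚ ℚ.+_) (ev-* (xpow m) (geometric m j)) ⟩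
    ev oneₚ ℚ.+ ev (xpow m) ℚ.* ev (geometric m j)
      ≡⟨ cong₂ (λ x y → ev oneₚ ℚ.+ x ℚ.* y) (ev-xpow m) (ev-geometric m j) ⟩
    ev oneₚ ℚ.+ 1ℚ ℚ.* (+ j) /1                ≡⟨ cong₂ ℚ._+_ (ev-xpow 0) (ℚP.*-identityˡ ((+ j) /1)) ⟩
    (+ 1) /1 ℚ.+ (+ j) /1                      ≡⟨ /1-+ (+ 1) (+ j) ⟨
    (+ suc j) /1                               ∎
    where open ≡-Reasoning

  ev-intPoly : ∀ f → ev (intPoly f) ≡ evalOne f /1
  ev-intPoly []      = refl
  ev-intPoly (z ∷ f) = trans (cong (z /1 ℚ.+_) (ev-intPoly f)) (sym (/1-+ z (evalOne f)))

-- Residue sums: for c < p, the sum of the coefficients of f at the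
-- exponents i ≡ c (mod p), i.e. the coefficient of q^c of f reduced
-- modulo q^p - 1.  Since Φ_p reduces to 1 + q + ⋯ + q^(p-1), every residue
-- sum of h Φ_p equals h(1); hence an integral multiple of Φ_p has value at
-- 1 divisible by p, even though h itself need not be integral a priori.
module ResidueSums (p : ℕ) where

  open import Data.Nat as ℕ using (zero; suc; _∸_; z≤n; s≤s)
  import Data.Nat.Properties as ℕP
  open import Data.Integer as ℤ using (+_)
  open import Data.Rational as ℚ using (ℚ; 0ℚ; 1ℚ)
  import Data.Rational.Properties as ℚP
  open import Data.List using ([]; _∷_; replicate; map)
  open import Data.List.Relation.Unary.All using ([]; _∷_)
  open import Data.Product using (_,_; proj₂)
  open import Relation.Binary.PropositionalEquality
  open import Data.Rational.Solver using (module +-*-Solver)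
  open +-*-Solver using (solve; _:=_; _:+_; _:-_)
  open PolynomialRing
  open IntegerEmbedding
  open IntegralPolynomials
  open ValueAtOne

  residueSum : ℕ → Poly → ℚ
  residueSum c       []      = 0ℚ
  residueSum zero    (a ∷ f) = a ℚ.+ residueSum (p ∸ 1) f
  residueSum (suc c) (a ∷ f) = residueSum c f

  residueSum-≋[] : ∀ c f → f ≋ [] → residueSum c f ≡ 0ℚ
  residueSum-≋[] c       []      e = refl
  residueSum-≋[] zero    (a ∷ f) e with ∷≋[]⁻¹ e
  ... | a≡0 , f≋[] = trans (cong₂ ℚ._+_ a≡0 (residueSum-≋[] _ f f≋[])) (ℚP.+-identityˡ 0ℚ)
  residueSum-≋[] (suc c) (a ∷ f) e = residueSum-≋[] c f (proj₂ (∷≋[]⁻¹ e))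

  residueSum-cong : ∀ c {f g} → f ≋ g → residueSum c f ≡ residueSum c g
  residueSum-cong c       {[]}    {g}     e = sym (residueSum-≋[] c g (≋-sym e))
  residueSum-cong c       {a ∷ f} {[]}    e = residueSum-≋[] c (a ∷ f) e
  residueSum-cong zero    {a ∷ f} {b ∷ g} e = cong₂ ℚ._+_ (at e zero) (residueSum-cong _ (∷-tail e))
  residueSum-cong (suc c) {a ∷ f} {b ∷ g} e = residueSum-cong c (∷-tail e)

  residueSum-+ : ∀ c f g → residueSum c (f +ₚ g) ≡ residueSum c f ℚ.+ residueSum c g
  residueSum-+ c       []      g       = sym (ℚP.+-identityˡ _)
  residueSum-+ c       (a ∷ f) []      = sym (ℚP.+-identityʳ _)
  residueSum-+ zero    (a ∷ f) (b ∷ g) = trans (cong ((a ℚ.+ b) ℚ.+_) (residueSum-+ _ f g))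
    (ℚ-interchange a b _ _)
  residueSum-+ (suc c) (a ∷ f) (b ∷ g) = residueSum-+ c f g

  predMod : ℕ → ℕ
  predMod zero    = p ∸ 1
  predMod (suc c) = c

  predMod-< : ∀ {c} → c ℕ.< p → predMod c ℕ.< p
  predMod-< {zero}  (s≤s z≤n) = ℕP.n<1+n _
  predMod-< {suc c} c<p       = ℕP.<-trans (ℕP.n<1+n c) c<p

  residueSum-shift : ∀ c f → residueSum c (shift f) ≡ residueSum (predMod c) f
  residueSum-shift zero    f = ℚP.+-identityˡ _
  residueSum-shift (suc c) f = refl

  residueSum-scale : ∀ c a g → residueSum c (scaleₚ a g) ≡ a ℚ.* residueSum c g
  residueSum-scale c       a []      = sym (ℚP.*-zeroʳ a)
  residueSum-scale zero    a (b ∷ g) =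
    trans (cong (a ℚ.* b ℚ.+_) (residueSum-scale _ a g)) (sym (ℚP.*-distribˡ-+ a b _))
  residueSum-scale (suc c) a (b ∷ g) = residueSum-scale c a g

  residueSum-replicate : ∀ n c a → c ℕ.< n → n ℕ.≤ p → residueSum c (replicate n a) ≡ a
  residueSum-replicate (suc n) zero    a _         n<p = trans (cong (a ℚ.+_) (beyond n (p ∸ 1) (ℕP.∸-monoˡ-≤ 1 n<p)))
    (ℚP.+-identityʳ a)
    where
    beyond : ∀ n c → n ℕ.≤ c → residueSum c (replicate n a) ≡ 0ℚ
    beyond zero    c       _         = refl
    beyond (suc n) (suc c) (s≤s n≤c) = beyond n c n≤c
  residueSum-replicate (suc n) (suc c) a (s≤s c<n) n<p = residueSum-replicate n c a c<n (ℕP.<⇒≤ n<p)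

  residueSum-multiple : ∀ c h → c ℕ.< p → residueSum c (h *ₚ Φ p) ≡ ev h
  residueSum-multiple c []      c<p = refl
  residueSum-multiple c (a ∷ h) c<p = begin
    residueSum c (scaleₚ a (Φ p) +ₚ shift (h *ₚ Φ p))
      ≡⟨ residueSum-+ c (scaleₚ a (Φ p)) (shift (h *ₚ Φ p)) ⟩
    residueSum c (scaleₚ a (Φ p)) ℚ.+ residueSum c (shift (h *ₚ Φ p))
      ≡⟨ cong₂ ℚ._+_ (residueSum-scale c a (Φ p)) (residueSum-shift c (h *ₚ Φ p)) ⟩
    a ℚ.* residueSum c (Φ p) ℚ.+ residueSum (predMod c) (h *ₚ Φ p)
      ≡⟨ cong₂ ℚ._+_ (cong (a ℚ.*_) (residueSum-replicate p c 1ℚ c<p ℕP.≤-refl))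
                     (residueSum-multiple (predMod c) h (predMod-< c<p)) ⟩
    a ℚ.* 1ℚ ℚ.+ ev h
      ≡⟨ cong (ℚ._+ ev h) (ℚP.*-identityʳ a) ⟩
    a ℚ.+ ev h ∎
    where open ≡-Reasoning

  isIntegral-residueSum : ∀ c {f} → Integral f → IsIntegral (residueSum c f)
  isIntegral-residueSum c       []       = isIntegral-0
  isIntegral-residueSum zero    (a ∷ If) = isIntegral-+ a (isIntegral-residueSum _ If)
  isIntegral-residueSum (suc c) (a ∷ If) = isIntegral-residueSum c If

  value-of-integral-multiple : 0 ℕ.< p → ∀ {D} h → D ≋ h *ₚ Φ p → Integral D →
    Σ ℤ λ s → ev D ≡ (+ p ℤ.* s) /1
  value-of-integral-multiple 0<p {D} h D≋hΦ ID with isIntegral-residueSum 0 ID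
  ... | s , sumD≡s = s , (begin
    ev D                    ≡⟨ ev-cong D≋hΦ ⟩
    ev (h *ₚ Φ p)           ≡⟨ ev-* h (Φ p) ⟩
    ev h ℚ.* ev (Φ p)       ≡⟨ cong₂ ℚ._*_ h[1]≡s (ev-qint p) ⟩
    s /1 ℚ.* (+ p) /1       ≡⟨ ℚP.*-comm (s /1) ((+ p) /1) ⟩
    (+ p) /1 ℚ.* s /1       ≡⟨ /1-* (+ p) s ⟨
    (+ p ℤ.* s) /1          ∎)
    where
    open ≡-Reasoning
    h[1]≡s : ev h ≡ s /1
    h[1]≡s = trans (sym (residueSum-multiple 0 h 0<p)) (trans (sym (residueSum-cong 0 D≋hΦ)) sumD≡s)

  open Congruence (Φ p) using (_≈ₘ_; _,_)

  values-congruent : 0 ℕ.< p → ∀ {F L a b} → F ≈ₘ L → Integral F → Integral L →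
    ev F ≡ a /1 → ev L ≡ b /1 → Σ ℤ λ s → a ≡ b ℤ.+ + p ℤ.* s
  values-congruent 0<p {F} {L} {a} {b} (h , F-L≋hΦ) IF IL F[1]≡a L[1]≡b
    with value-of-integral-multiple 0<p h F-L≋hΦ (integral-+ₚ IF (integral-neg IL))
  ... | s , [F-L][1]≡ps = s , /1-injective a (b ℤ.+ + p ℤ.* s) (begin
    a /1                             ≡⟨ solve 2 (λ x y → x := y :+ (x :- y)) refl (a /1) (b /1) ⟩
    b /1 ℚ.+ (a /1 ℚ.- b /1)         ≡⟨ cong (λ z → b /1 ℚ.+ z) [F-L][1] ⟨
    b /1 ℚ.+ ev (F -ₚ L)             ≡⟨ cong (λ z → b /1 ℚ.+ z) [F-L][1]≡ps ⟩
    b /1 ℚ.+ (+ p ℤ.* s) /1          ≡⟨ /1-+ b (+ p ℤ.* s) ⟨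
    (b ℤ.+ + p ℤ.* s) /1             ∎)
    where
    open ≡-Reasoning
    [F-L][1] : ev (F -ₚ L) ≡ a /1 ℚ.- b /1
    [F-L][1] = trans (ev-+ F (map ℚ.-_ L)) (cong₂ ℚ._+_ F[1]≡a (trans (ev-neg L) (cong ℚ.-_ L[1]≡b)))


module Compositions where

  open import Data.Nat using (zero; suc; _∸_; z≤n; s≤s)
  open import Data.Nat.Properties using (≤-trans; ≤-<-trans; m∸n≤m; <⇒≤; ∸-monoʳ-<; m∸n≢0⇒n<m; n>0⇒n≢0)
  open import Data.List using ([]; _∷_)
  open import Data.List.Relation.Unary.All as All using ([]; _∷_)
  open import Data.List.Relation.Unary.All.Properties using (map⁺; concat⁺; applyUpTo⁺₁)
  open import Data.Product using (_,_)
  open import Function using (id)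

  comps-suc-All : ∀ {P : List ℕ → Set} r n →
    (∀ j → j < n → All (λ ms → P (suc j ∷ ms)) (comps r (n ∸ suc j))) →
    All P (comps (suc r) n)
  comps-suc-All r n step = concat⁺ (map⁺ (map⁺ (applyUpTo⁺₁ id n λ {j} j<n → map⁺ (step j j<n))))

  comps-parts-≤ : ∀ r n → All (All (λ m → 1 ≤ m × m ≤ n)) (comps r n)
  comps-parts-≤ zero    zero    = [] ∷ []
  comps-parts-≤ zero    (suc n) = []
  comps-parts-≤ (suc r) n       = comps-suc-All r n λ j j<n →
    All.map (λ parts → (s≤s z≤n , j<n) ∷ All.map (λ (1≤m , m≤n-j) → 1≤m , ≤-trans m≤n-j (m∸n≤m n (suc j))) parts)
            (comps-parts-≤ r (n ∸ suc j))

  comps-target-positive : ∀ r n → All (λ _ → 1 ≤ n) (comps (suc r) n)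
  comps-target-positive r zero    = []
  comps-target-positive r (suc n) = All.universal (λ _ → s≤s z≤n) _

  comps-parts-< : ∀ r n → All (All (λ m → 1 ≤ m × m < n)) (comps (suc (suc r)) n)
  comps-parts-< r n = comps-suc-All (suc r) n λ j j<n →
    All.map (λ (1≤n-j , parts) → let j+1<n = m∸n≢0⇒n<m (n>0⇒n≢0 1≤n-j) in
               (s≤s z≤n , j+1<n)
             ∷ All.map (λ (1≤m , m≤n-j) → 1≤m , ≤-<-trans m≤n-j (∸-monoʳ-< (s≤s z≤n) (<⇒≤ j+1<n))) parts)
            (All.zip (comps-target-positive r (n ∸ suc j) , comps-parts-≤ (suc r) (n ∸ suc j)))

module OmegaModΦ (p : ℕ) where

  open import Data.Nat as ℕ using (_∸_; s≤s)
  open import Data.List using ([]; _∷_; map; zipWith)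
  open import Data.List.Relation.Unary.All as All using ([]; _∷_)
  open import Data.Product using (_,_)
  open PolynomialRing
  open Congruence (Φ p)
  open Compositions using (comps-parts-<)

  ≈[p]⇒≈ₘ : ∀ {f g} → f ≈[ p ] g → f ≈ₘ g
  ≈[p]⇒≈ₘ (h , e) = h , mk≋ e

  ≈ₘ⇒≈[p] : ∀ {f g} → f ≈ₘ g → f ≈[ p ] g
  ≈ₘ⇒≈[p] (h , e) = h , at e

  factor : (ℕ → Poly) → ℕ → ℕ → Poly
  factor u ka m = xpow ((ka ∸ 1) ℕ.* m) *ₚ (u m ^ₚ ka)

  summand : (ℕ → Poly) → List ℕ → List ℕ → Poly
  summand u k ms = prodₚ (zipWith (factor u) k ms)

  AgreeBelow : (ℕ → Poly) → (ℕ → Poly) → Set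
  AgreeBelow u v = ∀ m → 1 ≤ m → m < p → u m ≈ₘ v m

  summand-cong : ∀ {u v} → AgreeBelow u v → ∀ k {ms} → All (λ m → 1 ≤ m × m < p) ms →
    summand u k ms ≈ₘ summand v k ms
  summand-cong u≈v []       _                  = ≈ₘ-refl
  summand-cong u≈v (ka ∷ k) []                 = ≈ₘ-refl
  summand-cong u≈v (ka ∷ k) {m ∷ ms} ((1≤m , m<p) ∷ ms<p) = *ₚ-congₘ
    (*ₚ-congₘ (≈ₘ-refl {xpow ((ka ∸ 1) ℕ.* m)}) (^ₚ-congₘ ka (u≈v m 1≤m m<p)))
    (summand-cong u≈v k ms<p)

  ωζ-cong : ∀ {u v} → AgreeBelow u v → ∀ k → 2 ≤ length k → ωζ p k u ≈ₘ ωζ p k v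
  ωζ-cong u≈v k@(_ ∷ _ ∷ k′) (s≤s (s≤s _)) =
    sumₚ-congₘ (All.map (summand-cong u≈v k) (comps-parts-< (length k′) p))

  inverse-families-agree : ∀ {u v} → IsInvFamily p u → IsInvFamily p v → AgreeBelow u v
  inverse-families-agree u⁻¹ v⁻¹ m 1≤m m<p = inverse-unique (≈[p]⇒≈ₘ (u⁻¹ m 1≤m m<p)) (≈[p]⇒≈ₘ (v⁻¹ m 1≤m m<p))

-- For p prime, the family V(m) = 1 + q^m + ⋯ + q^(m(m′-1)), where m m′ ≡ 1
-- (mod p), inverts [m] modulo Φ_p; with it ω_p(k; ζ_p) has integer
-- coefficients, and its value at 1 is A(k) = Σ_ms ∏_a m′_a^(k_a).
module IntegralRepresentative {p : ℕ} (pp : Prime p) where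

  open import Data.Nat using (zero; suc; _+_; _*_; _^_; _∸_)
  open import Data.Integer using (+_)
  open import Data.Rational as ℚ using ()
  import Data.Rational.Properties as ℚP
  open import Data.List using ([]; _∷_; map; foldr; zipWith)
  open import Data.List.Relation.Unary.All using ([]; _∷_)
  open import Data.Product using (_,_)
  open import Relation.Binary.PropositionalEquality
  open PolynomialRing
  open Congruence (Φ p)
  open QIntegers
  open ModularInverse
  open IntegerEmbedding
  open IntegralPolynomials
  open ValueAtOne
  open OmegaModΦ p

  V : ℕ → Poly
  V m = geometric m (inverseMod pp m)

  V-inverse : IsInvFamily p V
  V-inverse m 1≤m m<p with inverseMod-correct pp m 1≤m m<p
  ... | t , mm′≡1+pt = ≈ₘ⇒≈[p] (begin
    V m *ₚ qint m             ≈⟨ ≋⇒≈ₘ (*ₚ-comm (V m) (qint m)) ⟩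
    qint m *ₚ V m             ≈⟨ ≋⇒≈ₘ (qint-*-geometric m (inverseMod pp m)) ⟩
    qint (m * inverseMod pp m) ≡⟨ cong qint mm′≡1+pt ⟩
    qint (1 + p * t)          ≈⟨ qint-1+p*t p t ⟩
    oneₚ                      ∎)
    where open ≈ₘ-Reasoning

  integral-geometric : ∀ m j → Integral (geometric m j)
  integral-geometric m zero    = []
  integral-geometric m (suc j) = integral-+ₚ integral-one (integral-*ₚ (integral-xpow m) (integral-geometric m j))

  -- The value at 1 of the summand of a composition ms.
  weight : List ℕ → List ℕ → ℕ
  weight k ms = foldr _*_ 1 (zipWith (λ ka m → inverseMod pp m ^ ka) k ms)

  integral-summand : ∀ k ms → Integral (summand V k ms)
  integral-summand []       ms       = integral-one
  integral-summand (ka ∷ k) []       = integral-one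
  integral-summand (ka ∷ k) (m ∷ ms) = integral-*ₚ
    (integral-*ₚ (integral-xpow ((ka ∸ 1) * m)) (integral-^ₚ ka (integral-geometric m (inverseMod pp m))))
    (integral-summand k ms)

  ev-summand : ∀ k ms → ev (summand V k ms) ≡ (+ weight k ms) /1
  ev-summand []       ms       = ev-xpow 0
  ev-summand (ka ∷ k) []       = ev-xpow 0
  ev-summand (ka ∷ k) (m ∷ ms) = begin
    ev (factor V ka m *ₚ summand V k ms)                       ≡⟨ ev-* (factor V ka m) (summand V k ms) ⟩
    ev (xpow ((ka ∸ 1) * m) *ₚ V m ^ₚ ka) ℚ.* ev (summand V k ms)
      ≡⟨ cong (ℚ._* ev (summand V k ms)) (ev-* (xpow ((ka ∸ 1) * m)) (V m ^ₚ ka)) ⟩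
    ev (xpow ((ka ∸ 1) * m)) ℚ.* ev (V m ^ₚ ka) ℚ.* ev (summand V k ms)
      ≡⟨ cong₂ (λ x y → x ℚ.* ev (V m ^ₚ ka) ℚ.* y) (ev-xpow ((ka ∸ 1) * m)) (ev-summand k ms) ⟩
    ℚ.1ℚ ℚ.* ev (V m ^ₚ ka) ℚ.* (+ weight k ms) /1
      ≡⟨ cong₂ ℚ._*_ (trans (ℚP.*-identityˡ _) (ev-^ₚ (V m) m′ ka (ev-geometric m m′))) refl ⟩
    (+ (m′ ^ ka)) /1 ℚ.* (+ weight k ms) /1                 ≡⟨ ℕ/1-* (m′ ^ ka) (weight k ms) ⟨
    (+ weight (ka ∷ k) (m ∷ ms)) /1                         ∎
    where
    open ≡-Reasoning
    m′ = inverseMod pp m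

  Aω : List ℕ → ℕ
  Aω k = foldr _+_ 0 (map (weight k) (comps (length k) p))

  integral-ωζ : ∀ k → Integral (ωζ p k V)
  integral-ωζ k = go (comps (length k) p)
    where
    go : ∀ cs → Integral (sumₚ (map (summand V k) cs))
    go []       = []
    go (ms ∷ cs) = integral-+ₚ (integral-summand k ms) (go cs)

  ev-ωζ : ∀ k → ev (ωζ p k V) ≡ (+ Aω k) /1
  ev-ωζ k = go (comps (length k) p)
    where
    go : ∀ cs → ev (sumₚ (map (summand V k) cs)) ≡ (+ foldr _+_ 0 (map (weight k) cs)) /1
    go []        = refl
    go (ms ∷ cs) = trans (ev-+ (summand V k ms) (sumₚ (map (summand V k) cs)))
      (trans (cong₂ ℚ._+_ (ev-summand k ms) (go cs)) (sym (ℕ/1-+ (weight k ms) _)))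

-- Reduction of p-integral rationals modulo a prime p.  The relation is set
-- up on unnormalised rationals, where addition needs no gcd, and transported
-- to ℚ through toℚᵘ.
module ReductionModP {p : ℕ} (pp : Prime p) where

  open import Data.Nat as ℕ using (zero; suc)
  import Data.Nat.Properties as ℕP
  import Data.Nat.Divisibility as ℕ∣
  open import Data.Nat.Primality using (euclidsLemma; prime⇒nonTrivial)
  import Data.Nat.Coprimality as Coprime
  open import Data.Integer as ℤ using (+_)
  import Data.Integer.Properties as ℤP
  open import Data.Integer.Divisibility.Signed as ℤ∣ using (_∣_; divides)
  open import Data.Rational as ℚ using (ℚ; mkℚ; 0ℚ; toℚᵘ)
  import Data.Rational.Properties as ℚP
  open import Data.Rational.Unnormalised as ℚᵘ using (ℚᵘ; mkℚᵘ; *≡*)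
  import Data.Rational.Unnormalised.Properties as ℚᵘP
  open import Data.Sum using (_⊎_; inj₁; inj₂)
  open import Data.Product using (_,_; proj₁)
  open import Relation.Binary.PropositionalEquality
  open import Relation.Nullary using (¬_; contradiction)
  open import Data.Integer.Solver using (module +-*-Solver)
  open +-*-Solver
  open ModularInverse using (OneMod)

  P : ℤ
  P = + p

  p≢1 : p ≢ 1
  p≢1 = ℕ.nonTrivial⇒≢1 {{prime⇒nonTrivial pp}}

  ¬P∣1 : ¬ P ∣ + 1
  ¬P∣1 P∣1 = p≢1 (ℕ∣.∣1⇒≡1 (ℤ∣.∣⇒∣ᵤ P∣1))

  P∣*⇒ : ∀ a b → P ∣ a ℤ.* b → P ∣ a ⊎ P ∣ b
  P∣*⇒ a b P∣ab with euclidsLemma ℤ.∣ a ∣ ℤ.∣ b ∣ pp (subst (p ℕ∣.∣_) (ℤP.abs-* a b) (ℤ∣.∣⇒∣ᵤ P∣ab))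
  ... | inj₁ p∣a = inj₁ (ℤ∣.∣ᵤ⇒∣ p∣a)
  ... | inj₂ p∣b = inj₂ (ℤ∣.∣ᵤ⇒∣ p∣b)

  Reduces : ℤ → ℚᵘ → Set
  Reduces a r = (¬ P ∣ ℚᵘ.↧ r) × P ∣ (a ℤ.* ℚᵘ.↧ r ℤ.- ℚᵘ.↥ r)

  reduces-+ : ∀ {a b} r s → Reduces a r → Reduces b s → Reduces (a ℤ.+ b) (r ℚᵘ.+ s)
  reduces-+ {a} {b} (mkℚᵘ n d) (mkℚᵘ n′ d′) (P∤D , P∣aD-n) (P∤D′ , P∣bD′-n′) =
    P∤DD′ , subst (P ∣_) (sym eq) (ℤ∣.∣m∣n⇒∣m+n (ℤ∣.∣m⇒∣m*n D′ P∣aD-n) (ℤ∣.∣m⇒∣m*n D P∣bD′-n′))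
    where
    D  = + suc d
    D′ = + suc d′
    P∤DD′ : ¬ P ∣ + (suc d ℕ.* suc d′)
    P∤DD′ P∣DD′ with P∣*⇒ D D′ (subst (P ∣_) (ℤP.pos-* (suc d) (suc d′)) P∣DD′)
    ... | inj₁ P∣D  = P∤D P∣D
    ... | inj₂ P∣D′ = P∤D′ P∣D′
    eq : (a ℤ.+ b) ℤ.* (+ (suc d ℕ.* suc d′)) ℤ.- (n ℤ.* D′ ℤ.+ n′ ℤ.* D)
       ≡ (a ℤ.* D ℤ.- n) ℤ.* D′ ℤ.+ (b ℤ.* D′ ℤ.- n′) ℤ.* D
    eq = trans (cong (λ z → (a ℤ.+ b) ℤ.* z ℤ.- (n ℤ.* D′ ℤ.+ n′ ℤ.* D)) (ℤP.pos-* (suc d) (suc d′)))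
      (solve 6 (λ a b n n′ D D′ → (a :+ b) :* (D :* D′) :- (n :* D′ :+ n′ :* D)
                  := (a :* D :- n) :* D′ :+ (b :* D′ :- n′) :* D) refl a b n n′ D D′)

  reduces-≃ : ∀ {a} r s → Reduces a r → r ℚᵘ.≃ s → ¬ P ∣ ℚᵘ.↧ s → Reduces a s
  reduces-≃ {a} r s (P∤Dr , P∣aDr-Nr) (*≡* Nr*Ds≡Ns*Dr) P∤Ds = P∤Ds , P∣aDs-Ns
    where
    Nr = ℚᵘ.↥ r
    Dr = ℚᵘ.↧ r
    Ns = ℚᵘ.↥ s
    Ds = ℚᵘ.↧ s
    eq : (a ℤ.* Ds ℤ.- Ns) ℤ.* Dr ≡ (a ℤ.* Dr ℤ.- Nr) ℤ.* Ds
    eq = trans (solve 5 (λ a Ds Ns Dr Nr → (a :* Ds :- Ns) :* Dr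
                                         := (a :* Dr :- Nr) :* Ds :+ (Nr :* Ds :- Ns :* Dr)) refl a Ds Ns Dr Nr)
        (trans (cong (λ z → (a ℤ.* Dr ℤ.- Nr) ℤ.* Ds ℤ.+ (z ℤ.- Ns ℤ.* Dr)) Nr*Ds≡Ns*Dr)
        (trans (cong (λ w → (a ℤ.* Dr ℤ.- Nr) ℤ.* Ds ℤ.+ w) (ℤP.+-inverseʳ (Ns ℤ.* Dr))) (ℤP.+-identityʳ _)))
    P∣aDs-Ns : P ∣ (a ℤ.* Ds ℤ.- Ns)
    P∣aDs-Ns with P∣*⇒ _ Dr (subst (P ∣_) (sym eq) (ℤ∣.∣m⇒∣m*n Ds P∣aDr-Nr))
    ... | inj₁ P∣ = P∣
    ... | inj₂ P∣Dr = contradiction P∣Dr P∤Dr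

  -- The normalised denominator divides every other denominator.
  normalised-denominator : ∀ r (z : ℚ) → r ℚᵘ.≃ toℚᵘ z → ¬ P ∣ ℚᵘ.↧ r → ¬ P ∣ ℚᵘ.↧ (toℚᵘ z)
  normalised-denominator r (mkℚ n d coprime) (*≡* eq) P∤Dr P∣Dz
    with P∣*⇒ n (ℚᵘ.↧ r) (subst (P ∣_) eq (ℤ∣.∣n⇒∣m*n (ℚᵘ.↥ r) P∣Dz))
  ... | inj₂ P∣Dr = P∤Dr P∣Dr
  ... | inj₁ P∣n  = p≢1 (Coprime.recompute coprime (ℤ∣.∣⇒∣ᵤ P∣n , ℤ∣.∣⇒∣ᵤ P∣Dz))

  ReducesQ : ℤ → ℚ → Set
  ReducesQ a x = Reduces a (toℚᵘ x)

  reducesQ-≃ : ∀ {a} r (x : ℚ) → Reduces a r → r ℚᵘ.≃ toℚᵘ x → ReducesQ a x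
  reducesQ-≃ {a} r x red r≃x = reduces-≃ {a} r (toℚᵘ x) red r≃x (normalised-denominator r x r≃x (proj₁ red))

  reducesQ-0 : ReducesQ (+ 0) 0ℚ
  reducesQ-0 = ¬P∣1 , divides (+ 0) refl

  reducesQ-+ : ∀ {a b} x y → ReducesQ a x → ReducesQ b y → ReducesQ (a ℤ.+ b) (x ℚ.+ y)
  reducesQ-+ {a} {b} x y red-x red-y = reducesQ-≃ {a ℤ.+ b} (toℚᵘ x ℚᵘ.+ toℚᵘ y) (x ℚ.+ y)
    (reduces-+ {a} {b} (toℚᵘ x) (toℚᵘ y) red-x red-y) (ℚᵘP.≃-sym (ℚP.toℚᵘ-homo-+ x y))

  reducesQ-recip : ∀ w n → OneMod p (w ℕ.* n) → ReducesQ (+ w) (recipℕ n)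
  reducesQ-recip w zero    (t , eq) = contradiction (trans (sym (ℕP.*-zeroʳ w)) eq) (λ ())
  reducesQ-recip w (suc d) (t , eq) = reducesQ-≃ {+ w} (mkℚᵘ (+ 1) d) (recipℕ (suc d)) (P∤n , P∣wn-1)
    (ℚᵘP.≃-sym (ℚP.toℚᵘ-fromℚᵘ (mkℚᵘ (+ 1) d)))
    where
    P∣wn-1 : P ∣ (+ w ℤ.* + suc d ℤ.- + 1)
    P∣wn-1 = divides (+ t) (begin
      + w ℤ.* + suc d ℤ.- + 1   ≡⟨ cong (ℤ._- + 1) (ℤP.pos-* w (suc d)) ⟨
      + (w ℕ.* suc d) ℤ.- + 1   ≡⟨ cong (λ z → + z ℤ.- + 1) eq ⟩
      + (1 ℕ.+ p ℕ.* t) ℤ.- + 1 ≡⟨ cong (ℤ._- + 1) (ℤP.pos-+ 1 (p ℕ.* t)) ⟩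
      + 1 ℤ.+ + (p ℕ.* t) ℤ.- + 1 ≡⟨ solve 2 (λ o x → o :+ x :- o := x) refl (+ 1) (+ (p ℕ.* t)) ⟩
      + (p ℕ.* t)               ≡⟨ ℤP.pos-* p t ⟩
      P ℤ.* + t                 ≡⟨ ℤP.*-comm P (+ t) ⟩
      + t ℤ.* P                 ∎)
      where open ≡-Reasoning
    P∤n : ¬ P ∣ + suc d
    P∤n P∣n = p≢1 (ℕ∣.∣1⇒≡1 (ℕ∣.∣m+n∣m⇒∣n p∣pt+1 (ℕ∣.m∣m*n t)))
      where
      p∣pt+1 : p ℕ∣.∣ p ℕ.* t ℕ.+ 1
      p∣pt+1 = subst (p ℕ∣.∣_) (trans eq (ℕP.+-comm 1 (p ℕ.* t))) (ℕ∣.∣n⇒∣m*n w (ℤ∣.∣⇒∣ᵤ P∣n))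

  reducesQ⇒RedEq : ∀ {a} x s → ReducesQ a x → RedEq p (a ℤ.+ P ℤ.* s) x
  reducesQ⇒RedEq {a} x@(mkℚ n d _) s (P∤D , P∣aD-n) =
    (λ P∣D → contradiction (ℤ∣.∣ᵤ⇒∣ P∣D) P∤D) ,
    (λ _ → ℤ∣.∣⇒∣ᵤ (subst (P ∣_) eq (ℤ∣.∣m∣n⇒∣m+n P∣aD-n (ℤ∣.∣m⇒∣m*n (s ℤ.* D) (ℤ∣.∣-refl {P})))))
    where
    D = + suc d
    eq : (a ℤ.* D ℤ.- n) ℤ.+ P ℤ.* (s ℤ.* D) ≡ (a ℤ.+ P ℤ.* s) ℤ.* D ℤ.- n
    eq = solve 5 (λ a D n P s → (a :* D :- n) :+ P :* (s :* D) := (a :+ P :* s) :* D :- n) refl a D n P s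

-- A(k) ≡ ω_p(k) (mod p): termwise, ∏ m′_a^(k_a) · ∏ m_a^(k_a) ≡ 1 (mod p).
module OmegaReduction {p : ℕ} (pp : Prime p) where

  open import Data.Nat using (zero; suc; _+_; _*_; _^_; s≤s)
  import Data.Nat.Properties as ℕP
  open import Data.Integer using (+_)
  import Data.Integer.Properties as ℤP
  open import Data.Rational as ℚ using (0ℚ)
  open import Data.List using ([]; _∷_; map; foldr; zipWith)
  open import Data.List.Relation.Unary.All using ([]; _∷_)
  open import Data.Product using (_,_)
  open import Relation.Binary.PropositionalEquality
  open import Algebra.Properties.CommutativeSemigroup ℕP.*-commutativeSemigroup using (interchange)
  open ModularInverse
  open IntegralRepresentative pp
  open ReductionModP pp
  open Compositions using (comps-parts-<)

  oneMod-1 : OneMod p 1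
  oneMod-1 = 0 , cong suc (sym (ℕP.*-zeroʳ p))

  oneMod-powers : ∀ {a b} → OneMod p (a * b) → ∀ n → OneMod p (b ^ n * a ^ n)
  oneMod-powers ab≡1 zero    = oneMod-1
  oneMod-powers {a} {b} ab≡1 (suc n) = subst (OneMod p)
    (trans (interchange a b (a ^ n) (b ^ n)) (ℕP.*-comm (a * a ^ n) (b * b ^ n)))
    (oneMod-* {p} ab≡1 (subst (OneMod p) (ℕP.*-comm (b ^ n) (a ^ n)) (oneMod-powers ab≡1 n)))

  denominator : List ℕ → List ℕ → ℕ
  denominator k ms = foldr _*_ 1 (zipWith (λ ka m → m ^ ka) k ms)

  weight-denominator : ∀ k {ms} → All (λ m → 1 ≤ m × m < p) ms → OneMod p (weight k ms * denominator k ms)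
  weight-denominator []       _  = oneMod-1
  weight-denominator (ka ∷ k) [] = oneMod-1
  weight-denominator (ka ∷ k) {m ∷ ms} ((1≤m , m<p) ∷ ms<p) = subst (OneMod p)
    (interchange (m′ ^ ka) (m ^ ka) (weight k ms) (denominator k ms))
    (oneMod-* {p} (oneMod-powers (inverseMod-correct pp m 1≤m m<p) ka) (weight-denominator k ms<p))
    where m′ = inverseMod pp m

  reduces-ω : ∀ k → 2 ≤ length k → ReducesQ (+ Aω k) (ωℚ p k)
  reduces-ω k@(_ ∷ _ ∷ k′) (s≤s (s≤s _)) = go (comps (length k) p) (comps-parts-< (length k′) p)
    where
    go : ∀ cs → All (All (λ m → 1 ≤ m × m < p)) cs →
      ReducesQ (+ foldr _+_ 0 (map (weight k) cs)) (foldr ℚ._+_ 0ℚ (map (λ ms → recipℕ (denominator k ms)) cs))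
    go []        []           = reducesQ-0
    go (ms ∷ cs) (ms<p ∷ cs<p) = subst (λ a → ReducesQ a (recipℕ (denominator k ms) ℚ.+ rest))
      (sym (ℤP.pos-+ (weight k ms) restWeight))
      (reducesQ-+ {+ weight k ms} {+ restWeight} (recipℕ (denominator k ms)) rest
        (reducesQ-recip (weight k ms) (denominator k ms) (weight-denominator k ms<p))
        (go cs cs<p))
      where
      rest       = foldr ℚ._+_ 0ℚ (map (λ ms → recipℕ (denominator k ms)) cs)
      restWeight = foldr _+_ 0 (map (weight k) cs)

-- Theorem 1.2.
theorem1p2 : (k : List ℕ) → All (1 ≤_) k → 2 ≤ length k →
  ((p : ℕ) → Prime p → Σ (List ℤ) (λ f → Represents p k f))
  × Σ ℕ (λ N → (p : ℕ) → Prime p → N < p → (f : List ℤ) →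
      Represents p k f → RedEq p (evalOne f) (ωℚ p k))
theorem1p2 k _ 2≤r = integral , 0 , reduction
  where
  open import Data.Product using (_,_)
  open import Data.Integer as ℤ using (+_)
  open import Relation.Binary.PropositionalEquality using (_≡_; subst; sym)
  open PolynomialRing using (≡⇒≋)
  open IntegralPolynomials using (toℤPoly; intPoly-toℤPoly; integral-intPoly)
  open ValueAtOne using (ev-intPoly)

  integral : (p : ℕ) → Prime p → Σ (List ℤ) (λ f → Represents p k f)
  integral p pp = toℤPoly (integral-ωζ k) , V , V-inverse ,
    ≈ₘ⇒≈[p] (≋⇒≈ₘ (≡⇒≋ (intPoly-toℤPoly (integral-ωζ k))))
    where
    open IntegralRepresentative pp
    open OmegaModΦ p using (≈ₘ⇒≈[p])
    open Congruence (Φ p) using (≋⇒≈ₘ)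

  -- Any representative f is congruent to it modulo Φ_p, so f(1) ≡ A(k) ≡ ω_p(k) (mod p).
  reduction : (p : ℕ) → Prime p → 0 < p → (f : List ℤ) → Represents p k f → RedEq p (evalOne f) (ωℚ p k)
  reduction p pp 0<p f (u , u⁻¹ , f≈ω) = conclude
    (values-congruent 0<p {a = evalOne f} {b = + Aω k} f≈ωV (integral-intPoly f) (integral-ωζ k) (ev-intPoly f) (ev-ωζ k))
    where
    open IntegralRepresentative pp
    open OmegaModΦ p
    open Congruence (Φ p) using (_≈ₘ_; ≈ₘ-trans)
    open ResidueSums p using (values-congruent)
    open ReductionModP pp using (P; reducesQ⇒RedEq)
    open OmegaReduction pp using (reduces-ω)
    f≈ωV : intPoly f ≈ₘ ωζ p k V
    f≈ωV = ≈ₘ-trans (≈[p]⇒≈ₘ f≈ω) (ωζ-cong (inverse-families-agree u⁻¹ V-inverse) k 2≤r)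
    conclude : Σ ℤ (λ s → evalOne f ≡ + Aω k ℤ.+ P ℤ.* s) → RedEq p (evalOne f) (ωℚ p k)
    conclude (s , f[1]≡A+ps) =
      subst (λ a → RedEq p a (ωℚ p k)) (sym f[1]≡A+ps) (reducesQ⇒RedEq {+ Aω k} (ωℚ p k) s (reduces-ω k 2≤r))
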